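{- Let $n$ and $c$ be integers with $n \ge c > 2$. Then $M^*_c(n) = \left\lceil \left\lceil n/2 \right\rceil \cdot \frac{n}{2} \right\rceil$.
   Context: There are $n$ balls, each colored with one of $c$ possible colors (not every color needs to occur). A query is a pair of balls, and its answer tells whether the two balls have the same color or not. A ball is a majority ball if its color class has more than $n/2$ balls. The majority problem is: determine whether a majority color exists and, if so, exhibit one ball of that color. In a non-adaptive strategy a set $Q$ of queries is fixed in advance and all answers are then received; $Q$ solves the problem if, for every coloring of the balls with at most $c$ colors, the answers to the queries in $Q$ determine the correct output. $M^*_c(n)$ denotes the minimum number of queries in a non-adaptive strategy solving the majority problem. -}

module Defs where

open import Data.Nat using (ℕ; _*_; _<_; _≤_; ⌈_/2⌉)
open import Data.Fin using (Fin)
open import Data.Fin.Properties using (_≟_)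
open import Data.List using (List; map; length; filter; allFin)
open import Data.Bool using (Bool)
open import Data.Maybe using (Maybe; just; nothing)
open import Data.Product using (_×_; _,_; ∃; ∃-syntax; Σ-syntax)
open import Relation.Nullary using (¬_; does)
open import Relation.Binary.PropositionalEquality using (_≡_)

-- Balls are Fin n, colours are Fin c; a colouring uses at most c colours.
Coloring : ℕ → ℕ → Set
Coloring n c = Fin n → Fin c

classSize : ∀ {n c} → Coloring n c → Fin n → ℕ
classSize {n} χ b = length (filter (λ i → χ i ≟ χ b) (allFin n))

IsMajorityBall : ∀ {n c} → Coloring n c → Fin n → Set
IsMajorityBall {n} χ b = n < 2 * classSize χ b

Query : ℕ → Set
Query n = Fin n × Fin n

answer : ∀ {n c} → Coloring n c → Query n → Bool
answer χ (i , j) = does (χ i ≟ χ j)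

-- Answers to a fixed (non-adaptive) list of queries.
answers : ∀ {n c} → Coloring n c → List (Query n) → List Bool
answers χ Q = map (answer χ) Q

CorrectOutput : ∀ {n c} → Coloring n c → Maybe (Fin n) → Set
CorrectOutput χ nothing  = ¬ (∃[ b ] IsMajorityBall χ b)
CorrectOutput χ (just b) = IsMajorityBall χ b

Solves : (n c : ℕ) → List (Query n) → Set
Solves n c Q = Σ[ out ∈ (List Bool → Maybe (Fin n)) ]
  (∀ (χ : Coloring n c) → CorrectOutput χ (out (answers χ Q)))

MinQueries : (c n k : ℕ) → Set
MinQueries c n k =
  (Σ[ Q ∈ List (Query n) ] (length Q ≡ k × Solves n c Q))
  × (∀ (Q : List (Query n)) → Solves n c Q → k ≤ length Q)

target : ℕ → ℕ
target n = ⌈ ⌈ n /2⌉ * n /2⌉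

-- If every set of more than n/2 balls induces a connected graph of queries, the "same colour"
-- answers connect the whole majority class, so a majority ball is found by searching the
-- components spanned by positive answers.  For n = 2k the complete bipartite graph K(k,k) has this
-- property; for n = 2k+1 take K(k+1,k), delete a matching of k-1 edges, and add a path through the
-- larger side and a cover of the matched vertices of the smaller side: ⌈⌈n/2⌉·n/2⌉ queries in both
-- cases.  Conversely, if a ball v is compared with fewer than ⌈n/2⌉ others, colour v together with
-- ⌊n/2⌋ balls never compared with v red and all other balls blue; recolouring v green destroys the
-- majority but changes no answer.  So every degree is at least ⌈n/2⌉, and 2|Q| ≥ n⌈n/2⌉.

module Submission where

open import Defs
open import Data.Bool using (Bool; true; false; T; not; _∧_; _∨_; if_then_else_)
open import Data.Bool.Properties using (∧-comm)
open import Data.Empty using (⊥; ⊥-elim)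
open import Data.Fin using (Fin; zero; suc; toℕ; fromℕ<)
open import Data.Fin.Properties using (_≟_; any?; toℕ<n; toℕ-injective; fromℕ<-toℕ; toℕ-fromℕ<)
open import Data.List using (List; []; _∷_; length; map; _++_; replicate; upTo; cartesianProduct; concatMap; filter; tabulate)
open import Data.List.Properties using (length-map; length-++; length-replicate; length-upTo; map-cong-local)
open import Data.List.Membership.Propositional using (_∈_)
open import Data.List.Membership.Propositional.Properties
  using (∈-map⁺; ∈-++⁺ˡ; ∈-++⁺ʳ; ∈-upTo⁺; ∈-upTo⁻; ∈-concatMap⁺; ∈-cartesianProduct⁺)
import Data.List.Relation.Unary.All as All
import Data.List.Relation.Unary.Any as Any
open import Data.List.Relation.Unary.Any using (here; there)
open import Data.Maybe using (Maybe; just; nothing)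
open import Data.Nat using (ℕ; zero; suc; _+_; _*_; _∸_; _≤_; _<_; z≤n; s≤s; s≤s⁻¹; _≤?_; _<?_; ⌊_/2⌋; ⌈_/2⌉)
import Data.Nat.Properties as ℕ
open import Data.Nat.Properties hiding (_≟_)
open import Algebra.Properties.CommutativeMonoid.Sum ℕ.+-0-commutativeMonoid using (sum; ∑-distrib-+)
open import Data.Nat.Tactic.RingSolver using (solve-∀)
open import Data.Product using (_×_; _,_; ∃; ∃-syntax; Σ-syntax; proj₁; proj₂)
import Data.Sum
open import Data.Sum using (_⊎_; inj₁; inj₂)
open import Data.Vec.Functional using () renaming (_∷_ to _∷ᶠ_)
open import Function using (_∘_)
open import Level using (Level)
open import Relation.Binary using (tri<; tri≈; tri>)
open import Relation.Binary.PropositionalEquality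
  using (_≡_; _≢_; refl; cong; cong₂; sym; trans; subst; subst₂; module ≡-Reasoning)
open import Relation.Nullary using (¬_; Dec; does; yes; no; contradiction)
open import Relation.Nullary.Decidable using (T?; decidable-stable; _×-dec_)

private variable
  a : Level
  A₁ A₂ : Set a
  n : ℕ

does⁺ : {a? : Dec A₁} → A₁ → T (does a?)
does⁺ {a? = yes _}  _ = _
does⁺ {a? = no ¬a} a = ¬a a

does⁻ : {a? : Dec A₁} → T (does a?) → A₁
does⁻ {a? = yes a} _ = a

≟⁺ : (i j : Fin n) → i ≡ j → T (does (i ≟ j))
≟⁺ i j = does⁺ {a? = i ≟ j}

≟⁻ : (i j : Fin n) → T (does (i ≟ j)) → i ≡ j
≟⁻ i j = does⁻ {a? = i ≟ j}

T-∧⁺ : ∀ {a b} → T a → T b → T (a ∧ b)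
T-∧⁺ {true} _ b = b

T-∧⁻ : ∀ a {b} → T (a ∧ b) → T a × T b
T-∧⁻ true b = _ , b

T-∨⁺ˡ : ∀ {a} b → T a → T (a ∨ b)
T-∨⁺ˡ {true} _ _ = _

T-∨⁺ʳ : ∀ a {b} → T b → T (a ∨ b)
T-∨⁺ʳ true  _ = _
T-∨⁺ʳ false b = b

T-∨⁻ : ∀ a {b} → T (a ∨ b) → T a ⊎ T b
T-∨⁻ true  a = inj₁ a
T-∨⁻ false b = inj₂ b

T-not⁺ : ∀ {a} → ¬ T a → T (not a)
T-not⁺ {true}  ¬a = ¬a _
T-not⁺ {false} _  = _

T-not⁻ : ∀ a → T (not a) → ¬ T a
T-not⁻ true ()

T-¬not : ∀ a → ¬ T (not a) → T a
T-¬not true  _     = _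
T-¬not false ¬true = ¬true _

DecSet : ℕ → Set
DecSet n = Fin n → Bool

_⊆_ : DecSet n → DecSet n → Set
X ⊆ Y = ∀ i → T (X i) → T (Y i)

∅ full : DecSet n
∅ _ = false
full _ = true

∁ : DecSet n → DecSet n
∁ X i = not (X i)

_∩_ _∪_ _∖_ : DecSet n → DecSet n → DecSet n
(X ∩ Y) i = X i ∧ Y i
(X ∪ Y) i = X i ∨ Y i
(X ∖ Y) i = X i ∧ not (Y i)

⁅_⁆ : Fin n → DecSet n
⁅ v ⁆ i = does (i ≟ v)

below : ℕ → DecSet n
below h i = does (toℕ i <? h)

below⁺ : ∀ h {i : Fin n} → toℕ i < h → T (below h i)
below⁺ h {i} = does⁺ {a? = toℕ i <? h}

below⁻ : ∀ h {i : Fin n} → T (below h i) → toℕ i < h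
below⁻ h {i} = does⁻ {a? = toℕ i <? h}

∩-⊆ˡ : (X Y : DecSet n) → (X ∩ Y) ⊆ X
∩-⊆ˡ X Y i = proj₁ ∘ T-∧⁻ (X i)

∩-⊆ʳ : (X Y : DecSet n) → (X ∩ Y) ⊆ Y
∩-⊆ʳ X Y i = proj₂ ∘ T-∧⁻ (X i)

count : DecSet n → ℕ
count {zero}  X = 0
count {suc n} X = if X zero then suc (count (X ∘ suc)) else count (X ∘ suc)

count-≤ : (X : DecSet n) → count X ≤ n
count-≤ {zero}  X = z≤n
count-≤ {suc n} X with X zero
... | true  = s≤s (count-≤ (X ∘ suc))
... | false = m≤n⇒m≤1+n (count-≤ (X ∘ suc))

count-cong : {X Y : DecSet n} → (∀ i → X i ≡ Y i) → count X ≡ count Y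
count-cong {zero}  e = refl
count-cong {suc n} {X} {Y} e with X zero | Y zero | e zero
... | true  | true  | refl = cong suc (count-cong (e ∘ suc))
... | false | false | refl = count-cong (e ∘ suc)

count-mono : {X Y : DecSet n} → X ⊆ Y → count X ≤ count Y
count-mono {zero}  sub = z≤n
count-mono {suc n} {X} {Y} sub with X zero | Y zero | sub zero
... | true  | true  | _  = s≤s (count-mono (sub ∘ suc))
... | false | true  | _  = m≤n⇒m≤1+n (count-mono (sub ∘ suc))
... | false | false | _  = count-mono (sub ∘ suc)
... | true  | false | s∈ = ⊥-elim (s∈ _)

count-mono-< : {X Y : DecSet n} (w : Fin n) → X ⊆ Y → ¬ T (X w) → T (Y w) → count X < count Y
count-mono-< {X = X} {Y} zero sub w∉X w∈Y with X zero | Y zero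
... | false | true = s≤s (count-mono (sub ∘ suc))
... | true  | _    = ⊥-elim (w∉X _)
count-mono-< {X = X} {Y} (suc w) sub w∉X w∈Y with X zero | Y zero | sub zero
... | true  | true  | _  = s≤s (count-mono-< w (sub ∘ suc) w∉X w∈Y)
... | false | true  | _  = m≤n⇒m≤1+n (count-mono-< w (sub ∘ suc) w∉X w∈Y)
... | false | false | _  = count-mono-< w (sub ∘ suc) w∉X w∈Y
... | true  | false | s∈ = ⊥-elim (s∈ _)

count-∅ : count (∅ {n}) ≡ 0
count-∅ {zero}  = refl
count-∅ {suc n} = count-∅ {n}

count-full : count (full {n}) ≡ n
count-full {zero}  = refl
count-full {suc n} = cong suc (count-full {n})

count-⁅⁆ : (v : Fin n) → count ⁅ v ⁆ ≡ 1
count-⁅⁆ {suc n} zero    = cong suc (count-∅ {n})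
count-⁅⁆ {suc n} (suc v) = trans (count-cong ⁅suc⁆) (count-⁅⁆ v)
  where
  ⁅suc⁆ : ∀ i → does (suc i ≟ suc v) ≡ does (i ≟ v)
  ⁅suc⁆ i with i ≟ v
  ... | yes _ = refl
  ... | no  _ = refl

count-split : (X Y : DecSet n) → count X ≡ count (X ∩ Y) + count (X ∖ Y)
count-split {zero}  X Y = refl
count-split {suc n} X Y with X zero | Y zero
... | true  | true  = cong suc (count-split (X ∘ suc) (Y ∘ suc))
... | true  | false = trans (cong suc (count-split (X ∘ suc) (Y ∘ suc))) (sym (+-suc _ _))
... | false | _     = count-split (X ∘ suc) (Y ∘ suc)

count-∪ : (X Y : DecSet n) → count (X ∪ Y) ≤ count X + count Y
count-∪ {zero}  X Y = z≤n
count-∪ {suc n} X Y with X zero | Y zero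
... | true  | true  = s≤s (≤-trans (count-∪ (X ∘ suc) (Y ∘ suc)) (≤-trans (n≤1+n _) (≤-reflexive (sym (+-suc _ _)))))
... | true  | false = s≤s (count-∪ (X ∘ suc) (Y ∘ suc))
... | false | true  = ≤-trans (s≤s (count-∪ (X ∘ suc) (Y ∘ suc))) (≤-reflexive (sym (+-suc _ _)))
... | false | false = count-∪ (X ∘ suc) (Y ∘ suc)

count-witness : (X : DecSet n) → 0 < count X → ∃ (T ∘ X)
count-witness {suc n} X pos with X zero in eq
... | true  = zero , subst T (sym eq) _
... | false with count-witness (X ∘ suc) pos
... | i , i∈X = suc i , i∈X

count-pos : (X : DecSet n) (w : Fin n) → T (X w) → 0 < count X
count-pos {n} X w w∈X = subst (_< count X) (count-∅ {n}) (count-mono-< w (λ _ ()) (λ ()) w∈X)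

count-≤1 : (X : DecSet n) (w : Fin n) → (∀ i → T (X i) → i ≡ w) → count X ≤ 1
count-≤1 X w only-w = ≤-trans (count-mono ⊆⁅w⁆) (≤-reflexive (count-⁅⁆ w))
  where
  ⊆⁅w⁆ : X ⊆ ⁅ w ⁆
  ⊆⁅w⁆ i i∈X = ≟⁺ i w (only-w i i∈X)

count-below : (h : ℕ) → h ≤ n → count (below {n} h) ≡ h
count-below {n} zero    _ = count-∅ {n}
count-below {suc n} (suc h) (s≤s h≤n) = cong suc (trans (count-cong {n} below-suc) (count-below h h≤n))
  where
  below-suc : ∀ i → does (suc (toℕ i) <? suc h) ≡ does (toℕ i <? h)
  below-suc i with toℕ i <? h
  ... | yes _ = refl
  ... | no  _ = refl

count-∁ : (X : DecSet n) → count X + count (∁ X) ≡ n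
count-∁ {n} X = sym (trans (sym (count-full {n})) (count-split full X))

count-escape : (W X : DecSet n) → count X < count W → ∃ λ z → T (W z) × ¬ T (X z)
count-escape W X X<W with count-witness (W ∖ X) escapees
  where
  open ≤-Reasoning
  escapees : 0 < count (W ∖ X)
  escapees = +-cancelˡ-< (count X) 0 (count (W ∖ X)) (begin-strict
    count X + 0                    ≡⟨ +-identityʳ (count X) ⟩
    count X                        <⟨ X<W ⟩
    count W                        ≡⟨ count-split W X ⟩
    count (W ∩ X) + count (W ∖ X)  ≤⟨ +-monoˡ-≤ (count (W ∖ X)) (count-mono (∩-⊆ʳ W X)) ⟩
    count X + count (W ∖ X)        ∎)
... | z , z∈W∖X = z , ∩-⊆ˡ W (∁ X) z z∈W∖X , T-not⁻ (X z) (∩-⊆ʳ W (∁ X) z z∈W∖X)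

empty-or-witness : (X : DecSet n) → (∀ z → ¬ T (X z)) ⊎ ∃ (T ∘ X)
empty-or-witness X with any? (λ z → T? (X z))
... | yes z∈X = inj₂ z∈X
... | no  ∄z  = inj₁ λ z z∈X → ∄z (z , z∈X)

singleton-or-other : (X : DecSet n) (w : Fin n) → (∀ z → T (X z) → z ≡ w) ⊎ ∃ λ z → T (X z) × z ≢ w
singleton-or-other X w with empty-or-witness (X ∖ ⁅ w ⁆)
... | inj₁ X⊆⁅w⁆ = inj₁ λ z z∈X → decidable-stable (z ≟ w) λ z≢w → X⊆⁅w⁆ z (T-∧⁺ z∈X (T-not⁺ (z≢w ∘ ≟⁻ z w)))
... | inj₂ (z , z∈X∖w) = inj₂ (z , ∩-⊆ˡ X (∁ ⁅ w ⁆) z z∈X∖w , T-not⁻ _ (∩-⊆ʳ X (∁ ⁅ w ⁆) z z∈X∖w) ∘ ≟⁺ z w)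

count-mono-<₂ : {X Y : DecSet n} (w₁ w₂ : Fin n) → w₁ ≢ w₂ → X ⊆ Y →
  ¬ T (X w₁) → ¬ T (X w₂) → T (Y w₁) → T (Y w₂) → 2 + count X ≤ count Y
count-mono-<₂ {X = X} {Y} w₁ w₂ w₁≢w₂ X⊆Y w₁∉X w₂∉X w₁∈Y w₂∈Y =
  ≤-trans (s≤s (count-mono-< w₁ (λ i → T-∨⁺ˡ _) w₁∉X (T-∨⁺ʳ (X w₁) (≟⁺ w₁ w₁ refl))))
          (count-mono-< w₂ X₁⊆Y w₂∉X₁ w₂∈Y)
  where
  X₁ : DecSet _
  X₁ = X ∪ ⁅ w₁ ⁆
  X₁⊆Y : X₁ ⊆ Y
  X₁⊆Y i i∈X₁ with T-∨⁻ (X i) i∈X₁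
  ... | inj₁ i∈X  = X⊆Y i i∈X
  ... | inj₂ i≡w₁ rewrite ≟⁻ i w₁ i≡w₁ = w₁∈Y
  w₂∉X₁ : ¬ T (X₁ w₂)
  w₂∉X₁ w₂∈X₁ with T-∨⁻ (X w₂) w₂∈X₁
  ... | inj₁ w₂∈X  = w₂∉X w₂∈X
  ... | inj₂ w₂≡w₁ = w₁≢w₂ (sym (≟⁻ w₂ w₁ w₂≡w₁))

count-none : (X : DecSet n) → (∀ z → ¬ T (X z)) → count X ≤ 0
count-none {n} X none = ≤-trans (count-mono {Y = ∅} λ z z∈X → none z z∈X) (≤-reflexive (count-∅ {n}))

∪-comm-⊆ : (X Y : DecSet n) → (X ∪ Y) ⊆ (Y ∪ X)
∪-comm-⊆ X Y i i∈X∪Y with T-∨⁻ (X i) i∈X∪Y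
... | inj₁ i∈X = T-∨⁺ʳ (Y i) i∈X
... | inj₂ i∈Y = T-∨⁺ˡ _ i∈Y

n<2*[1+⌊n/2⌋] : ∀ n → n < 2 * suc ⌊ n /2⌋
n<2*[1+⌊n/2⌋] zero          = s≤s z≤n
n<2*[1+⌊n/2⌋] (suc zero)    = s≤s (s≤s z≤n)
n<2*[1+⌊n/2⌋] (suc (suc n)) = subst (suc (suc (suc n)) ≤_) (sym (*-suc 2 (suc ⌊ n /2⌋))) (s≤s (s≤s (n<2*[1+⌊n/2⌋] n)))

2*⌊n/2⌋≤n : ∀ n → 2 * ⌊ n /2⌋ ≤ n
2*⌊n/2⌋≤n zero          = z≤n
2*⌊n/2⌋≤n (suc zero)    = z≤n
2*⌊n/2⌋≤n (suc (suc n)) = subst (_≤ suc (suc n)) (sym (*-suc 2 ⌊ n /2⌋)) (s≤s (s≤s (2*⌊n/2⌋≤n n)))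

m≤2*n⇒⌈m/2⌉≤n : ∀ {m} n → m ≤ 2 * n → ⌈ m /2⌉ ≤ n
m≤2*n⇒⌈m/2⌉≤n {m} n m≤2n = ≤-trans (⌈n/2⌉-mono m≤2n)
  (≤-reflexive (sym (trans (n≡⌈n+n/2⌉ n) (cong (λ x → ⌈ n + x /2⌉) (sym (+-identityʳ n))))))

small-complement : ∀ {n a b} → suc ⌊ n /2⌋ ≤ a → a + b ≡ n → b ≤ ⌊ n /2⌋
small-complement {n} {a} {b} f<a a+b≡n = s≤s⁻¹ (+-cancelˡ-< (suc f) b (suc f) (begin-strict
  suc f + b      ≤⟨ +-monoˡ-≤ b f<a ⟩
  a + b          ≡⟨ a+b≡n ⟩
  n              <⟨ n<2*[1+⌊n/2⌋] n ⟩
  2 * suc f      ≡⟨ cong (suc f +_) (+-identityʳ (suc f)) ⟩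
  suc f + suc f  ∎))
  where
  open ≤-Reasoning
  f = ⌊ n /2⌋

large-complement : ∀ {n a b} → b ≤ ⌈ n /2⌉ → a + b ≡ n → ⌊ n /2⌋ ≤ a
large-complement {n} {a} {b} b≤h a+b≡n = +-cancelʳ-≤ ⌈ n /2⌉ ⌊ n /2⌋ a (begin
  ⌊ n /2⌋ + ⌈ n /2⌉  ≡⟨ ⌊n/2⌋+⌈n/2⌉≡n n ⟩
  n                  ≡⟨ sym a+b≡n ⟩
  a + b              ≤⟨ +-monoʳ-≤ a b≤h ⟩
  a + ⌈ n /2⌉        ∎)
  where open ≤-Reasoning

2*m≤n⇒m≤⌊n/2⌋ : ∀ m {n} → 2 * m ≤ n → m ≤ ⌊ n /2⌋
2*m≤n⇒m≤⌊n/2⌋ m 2m≤n =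
  ≤-trans (≤-reflexive (trans (n≡⌊n+n/2⌋ m) (cong (λ x → ⌊ m + x /2⌋) (sym (+-identityʳ m))))) (⌊n/2⌋-mono 2m≤n)

length-cartesianProduct : (xs : List A₁) (ys : List A₂) → length (cartesianProduct xs ys) ≡ length xs * length ys
length-cartesianProduct []       ys = refl
length-cartesianProduct (x ∷ xs) ys =
  trans (length-++ (map (x ,_) ys)) (cong₂ _+_ (length-map (x ,_) ys) (length-cartesianProduct xs ys))

-- Numbers out of range are sent to the default ball d.
toFin : Fin n → ℕ → Fin n
toFin {n} d i with i <? n
... | yes i<n = fromℕ< i<n
... | no  _   = d

toFin-toℕ : (d u : Fin n) → toFin d (toℕ u) ≡ u
toFin-toℕ {n} d u with toℕ u <? n
... | yes u<n = fromℕ<-toℕ u u<n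
... | no  u≮n = ⊥-elim (u≮n (toℕ<n u))

toℕ-toFin : (d : Fin n) {i : ℕ} → i < n → toℕ (toFin d i) ≡ i
toℕ-toFin {n} d {i} i<n with i <? n
... | yes i<n′ = toℕ-fromℕ< i<n′
... | no  i≮n = ⊥-elim (i≮n i<n)

liftQueries : Fin n → List (ℕ × ℕ) → List (Query n)
liftQueries d = map λ (i , j) → toFin d i , toFin d j

∈-liftQueries : (d : Fin n) {E : List (ℕ × ℕ)} {p q : Fin n} → (toℕ p , toℕ q) ∈ E → (p , q) ∈ liftQueries d E
∈-liftQueries d {E} {p} {q} pq∈E =
  subst₂ (λ p′ q′ → (p′ , q′) ∈ liftQueries d E) (toFin-toℕ d p) (toFin-toℕ d q) (∈-map⁺ _ pq∈E)

∈-concatMap⁺′ : (f : A₁ → List A₂) {x : A₁} {y : A₂} {xs : List A₁} → x ∈ xs → y ∈ f x → y ∈ concatMap f xs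
∈-concatMap⁺′ f x∈xs y∈fx = ∈-concatMap⁺ f (Any.map (λ { refl → y∈fx }) x∈xs)

length-concatMap : (f : A₁ → List A₂) {m : ℕ} (xs : List A₁) → (∀ {x} → x ∈ xs → length (f x) ≡ m) →
                   length (concatMap f xs) ≡ length xs * m
length-concatMap f []       _   = refl
length-concatMap f (x ∷ xs) len =
  trans (length-++ (f x)) (cong₂ _+_ (len (here refl)) (length-concatMap f xs (len ∘ there)))

-- Queries connecting every majority-sized set solve the problem

colourClass : ∀ {c} → Coloring n c → Fin n → DecSet n
colourClass χ b u = does (χ u ≟ χ b)

classSize≡count : ∀ {c} (χ : Coloring n c) (b : Fin n) → classSize χ b ≡ count (colourClass χ b)
classSize≡count {n} χ b = go (λ i → i)
  where
  go : ∀ {m} (f : Fin m → Fin n) →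
       length (filter (λ i → χ i ≟ χ b) (tabulate f)) ≡ count (λ i → does (χ (f i) ≟ χ b))
  go {zero}  f = refl
  go {suc m} f with χ (f zero) ≟ χ b
  ... | yes _ = cong suc (go (f ∘ suc))
  ... | no  _ = go (f ∘ suc)

majority⇒count : ∀ {c} (χ : Coloring n c) (b : Fin n) → IsMajorityBall χ b → n < 2 * count (colourClass χ b)
majority⇒count {n} χ b = subst (λ s → n < 2 * s) (classSize≡count χ b)

count⇒majority : ∀ {c} (χ : Coloring n c) (b : Fin n) → n < 2 * count (colourClass χ b) → IsMajorityBall χ b
count⇒majority {n} χ b = subst (λ s → n < 2 * s) (sym (classSize≡count χ b))

Disjoint : DecSet n → DecSet n → Set
Disjoint X Y = ∀ i → T (X i) → ¬ T (Y i)

CrossingQuery : List (Query n) → DecSet n → DecSet n → Set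
CrossingQuery {n} Q X Y =
  ∃[ p ] ∃[ q ] ((p , q) ∈ Q × ((T (X p) × T (Y q)) ⊎ (T (X q) × T (Y p))))

CrossingQuery-sym : {Q : List (Query n)} {X Y : DecSet n} → CrossingQuery Q X Y → CrossingQuery Q Y X
CrossingQuery-sym (p , q , pq∈Q , inj₁ (p∈X , q∈Y)) = p , q , pq∈Q , inj₂ (q∈Y , p∈X)
CrossingQuery-sym (p , q , pq∈Q , inj₂ (q∈X , p∈Y)) = p , q , pq∈Q , inj₁ (p∈Y , q∈X)

MajorityConnected : List (Query n) → Set
MajorityConnected {n} Q = ∀ (X Y : DecSet n) → Disjoint X Y → n < 2 * count (X ∪ Y) →
  ∃ (T ∘ X) → ∃ (T ∘ Y) → CrossingQuery Q X Y

joins : Query n → Fin n → Fin n → Bool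
joins (a , b) z y = ⁅ a ⁆ z ∧ ⁅ b ⁆ y ∨ ⁅ a ⁆ y ∧ ⁅ b ⁆ z

linked : List (Query n) → List Bool → Fin n → Fin n → Bool
linked []      _        z y = false
linked (_ ∷ _) []       z y = false
linked (q ∷ Q) (r ∷ rs) z y = r ∧ joins q z y ∨ linked Q rs z y

reach : List (Query n) → List Bool → ℕ → Fin n → DecSet n
reach Q rs zero    x   = ⁅ x ⁆
reach Q rs (suc t) x y = reach Q rs t x y ∨ does (any? λ z → T? (reach Q rs t x z ∧ linked Q rs z y))

decode : List (Query n) → List Bool → Maybe (Fin n)
decode {n} Q rs with any? (λ x → n <? 2 * count (reach Q rs n x))
... | yes (x , _) = just x
... | no _        = nothing

reach-refl : (Q : List (Query n)) (rs : List Bool) (t : ℕ) (x : Fin n) → T (reach Q rs t x x)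
reach-refl Q rs zero    x = ≟⁺ x x refl
reach-refl Q rs (suc t) x = T-∨⁺ˡ _ (reach-refl Q rs t x)

reach-step : (Q : List (Query n)) (rs : List Bool) (t : ℕ) {x z y : Fin n} →
             T (reach Q rs t x z) → T (linked Q rs z y) → T (reach Q rs (suc t) x y)
reach-step Q rs t {x} {z} {y} x↝z z~y =
  T-∨⁺ʳ (reach Q rs t x y) (does⁺ {a? = any? λ z → T? (reach Q rs t x z ∧ linked Q rs z y)} (z , T-∧⁺ x↝z z~y))

module _ {c : ℕ} (χ : Coloring n c) where

  linked-sound : (Q : List (Query n)) {z y : Fin n} → T (linked Q (answers χ Q) z y) → χ z ≡ χ y
  linked-sound ((a , b) ∷ Q) {z} {y} l with T-∨⁻ (does (χ a ≟ χ b) ∧ joins (a , b) z y) l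
  ... | inj₂ l′ = linked-sound Q l′
  ... | inj₁ same-joins with T-∧⁻ (does (χ a ≟ χ b)) same-joins
  ... | same , j with T-∨⁻ (⁅ a ⁆ z ∧ ⁅ b ⁆ y) j
  ... | inj₁ zy≡ab with T-∧⁻ (⁅ a ⁆ z) zy≡ab
  ... | z≡a , y≡b rewrite ≟⁻ z a z≡a | ≟⁻ y b y≡b = ≟⁻ (χ a) (χ b) same
  linked-sound ((a , b) ∷ Q) {z} {y} l | inj₁ _ | same , _ | inj₂ yz≡ab with T-∧⁻ (⁅ a ⁆ y) yz≡ab
  ... | y≡a , z≡b rewrite ≟⁻ y a y≡a | ≟⁻ z b z≡b = sym (≟⁻ (χ a) (χ b) same)

  linked-complete : (Q : List (Query n)) {p q : Fin n} → (p , q) ∈ Q → χ p ≡ χ q →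
                    T (linked Q (answers χ Q) p q) × T (linked Q (answers χ Q) q p)
  linked-complete ((a , b) ∷ Q) (here refl) χa≡χb =
    T-∨⁺ˡ _ (T-∧⁺ same (T-∨⁺ˡ _ ab≡ab)) , T-∨⁺ˡ _ (T-∧⁺ same (T-∨⁺ʳ (⁅ a ⁆ b ∧ ⁅ b ⁆ a) ab≡ab))
    where
    same = ≟⁺ (χ a) (χ b) χa≡χb
    ab≡ab = T-∧⁺ (≟⁺ a a refl) (≟⁺ b b refl)
  linked-complete ((a , b) ∷ Q) (there pq∈Q) e with linked-complete Q pq∈Q e
  ... | p~q , q~p = T-∨⁺ʳ _ p~q , T-∨⁺ʳ _ q~p

  reach-sound : (Q : List (Query n)) (t : ℕ) {x y : Fin n} → T (reach Q (answers χ Q) t x y) → χ x ≡ χ y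
  reach-sound Q zero    {x} {y} x↝y = cong χ (sym (≟⁻ y x x↝y))
  reach-sound Q (suc t) {x} {y} x↝y with T-∨⁻ (reach Q (answers χ Q) t x y) x↝y
  ... | inj₁ x↝y′ = reach-sound Q t x↝y′
  ... | inj₂ via with does⁻ {a? = any? λ z → T? (reach Q (answers χ Q) t x z ∧ linked Q (answers χ Q) z y)} via
  ... | z , x↝z~y with T-∧⁻ (reach Q (answers χ Q) t x z) x↝z~y
  ... | x↝z , z~y = trans (reach-sound Q t x↝z) (linked-sound Q z~y)

module Spanning {c : ℕ} (Q : List (Query n)) (conn : MajorityConnected Q)
                (χ : Coloring n c) (b : Fin n) (maj : n < 2 * count (colourClass χ b)) where

  M : DecSet n
  M = colourClass χ b

  R : ℕ → DecSet n
  R t = reach Q (answers χ Q) t b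

  same-colour : ∀ {u} → T (M u) → χ u ≡ χ b
  same-colour {u} = ≟⁻ (χ u) (χ b)

  module _ (t : ℕ) where

    X Y : DecSet n
    X = M ∩ R t
    Y = M ∖ R t

    disjoint : Disjoint X Y
    disjoint u u∈X u∈Y = T-not⁻ (R t u) (∩-⊆ʳ M (∁ (R t)) u u∈Y) (∩-⊆ʳ M (R t) u u∈X)

    M⊆X∪Y : M ⊆ (X ∪ Y)
    M⊆X∪Y u u∈M with T? (R t u)
    ... | yes u∈R = T-∨⁺ˡ _ (T-∧⁺ u∈M u∈R)
    ... | no  u∉R = T-∨⁺ʳ (M u ∧ R t u) (T-∧⁺ u∈M (T-not⁺ u∉R))

    b∈X : T (X b)
    b∈X = T-∧⁺ (≟⁺ (χ b) (χ b) refl) (reach-refl Q (answers χ Q) t b)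

    same-colours : ∀ {u v} → T (X u) → T (Y v) → χ u ≡ χ v
    same-colours {u} {v} u∈X v∈Y =
      trans (same-colour (∩-⊆ˡ M (R t) u u∈X)) (sym (same-colour (∩-⊆ˡ M (∁ (R t)) v v∈Y)))

    grows-via : ∀ {u v} → T (X u) → T (Y v) → T (linked Q (answers χ Q) u v) → count X < count (M ∩ R (suc t))
    grows-via {u} {v} u∈X v∈Y u~v =
      count-mono-< v X⊆X′ (λ v∈X → disjoint v v∈X v∈Y) (T-∧⁺ (∩-⊆ˡ M (∁ (R t)) v v∈Y) v∈R′)
      where
      X⊆X′ : X ⊆ (M ∩ R (suc t))
      X⊆X′ w w∈X with T-∧⁻ (M w) w∈X
      ... | w∈M , w∈R = T-∧⁺ w∈M (T-∨⁺ˡ _ w∈R)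
      v∈R′ : T (R (suc t) v)
      v∈R′ = reach-step Q (answers χ Q) t (∩-⊆ʳ M (R t) u u∈X) u~v

    reach-grows : ∃ (T ∘ Y) → count X < count (M ∩ R (suc t))
    reach-grows y∈Y with conn X Y disjoint (<-≤-trans maj (*-monoʳ-≤ 2 (count-mono M⊆X∪Y))) (b , b∈X) y∈Y
    ... | p , q , pq∈Q , inj₁ (p∈X , q∈Y) =
          grows-via p∈X q∈Y (proj₁ (linked-complete χ Q pq∈Q (same-colours p∈X q∈Y)))
    ... | p , q , pq∈Q , inj₂ (q∈X , p∈Y) =
          grows-via q∈X p∈Y (proj₂ (linked-complete χ Q pq∈Q (sym (same-colours q∈X p∈Y))))

  class-reached : ∀ t → M ⊆ R t ⊎ t < count (M ∩ R t)
  class-reached zero = inj₂ (count-pos (M ∩ R zero) b (b∈X zero))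
  class-reached (suc t) with class-reached t
  ... | inj₁ M⊆R = inj₁ (λ u u∈M → T-∨⁺ˡ _ (M⊆R u u∈M))
  ... | inj₂ t<count with any? (λ y → T? (Y t y))
  ... | yes y∈Y = inj₂ (≤-trans (s≤s t<count) (reach-grows t y∈Y))
  ... | no  ∄y  = inj₁ M⊆R′
    where
    M⊆R′ : M ⊆ R (suc t)
    M⊆R′ u u∈M with T? (R t u)
    ... | yes u∈R = T-∨⁺ˡ _ u∈R
    ... | no  u∉R = ⊥-elim (∄y (u , T-∧⁺ u∈M (T-not⁺ u∉R)))

  class-spanned : M ⊆ R n
  class-spanned with class-reached n
  ... | inj₁ M⊆R   = M⊆R
  ... | inj₂ n<count = ⊥-elim (1+n≰n (≤-trans n<count (count-≤ (M ∩ R n))))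

majorityConnected⇒solves : ∀ {c} (Q : List (Query n)) → MajorityConnected Q → Solves n c Q
majorityConnected⇒solves {n} {c} Q conn = decode Q , correct
  where
  correct : (χ : Coloring n c) → CorrectOutput χ (decode Q (answers χ Q))
  correct χ with any? (λ x → n <? 2 * count (reach Q (answers χ Q) n x))
  ... | yes (x , big) = count⇒majority χ x (<-≤-trans big (*-monoʳ-≤ 2 (count-mono reach⊆class)))
    where
    reach⊆class : reach Q (answers χ Q) n x ⊆ colourClass χ x
    reach⊆class u x↝u = ≟⁺ (χ u) (χ x) (sym (reach-sound χ Q n x↝u))
  ... | no ∄x = λ (b , maj) → ∄x (b , spanned b (majority⇒count χ b maj))
    where
    spanned : ∀ b → n < 2 * count (colourClass χ b) → n < 2 * count (reach Q (answers χ Q) n b)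
    spanned b maj = <-≤-trans maj (*-monoʳ-≤ 2 (count-mono (Spanning.class-spanned Q conn χ b maj)))

MajorityConnected-++ : (Q P : List (Query n)) → MajorityConnected Q → MajorityConnected (Q ++ P)
MajorityConnected-++ Q P conn X Y disj maj x∈X y∈Y with conn X Y disj maj x∈X y∈Y
... | p , q , pq∈Q , side = p , q , ∈-++⁺ˡ pq∈Q , side

padTo : Fin n → (t : ℕ) (Q : List (Query n)) → length Q ≤ t → MajorityConnected Q →
        Σ[ Q′ ∈ List (Query n) ] (length Q′ ≡ t × MajorityConnected Q′)
padTo d t Q Q≤t conn =
  Q ++ replicate (t ∸ length Q) (d , d) ,
  trans (length-++ Q) (trans (cong (length Q +_) (length-replicate (t ∸ length Q))) (m+[n∸m]≡n Q≤t)) ,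
  MajorityConnected-++ Q _ conn

-- Even n: the complete bipartite graph

bipartite⇒majorityConnected : (Q : List (Query n)) (S : DecSet n) →
  (∀ {p q} → T (S p) → ¬ T (S q) → (p , q) ∈ Q) → 2 * count S ≤ n → 2 * count (∁ S) ≤ n → MajorityConnected Q
bipartite⇒majorityConnected {n} Q S cross S-small ∁S-small X Y disj maj (x , x∈X) (y , y∈Y)
  with T? (S x) | T? (S y)
... | yes x∈S | no y∉S = x , y , cross x∈S y∉S , inj₁ (x∈X , y∈Y)
... | no x∉S | yes y∈S = y , x , cross y∈S x∉S , inj₂ (x∈X , y∈Y)
... | yes x∈S | yes y∈S with count-escape (X ∪ Y) S (*-cancelˡ-< 2 _ _ (≤-<-trans S-small maj))
...   | z , z∈X∪Y , z∉S with T-∨⁻ (X z) z∈X∪Y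
...     | inj₁ z∈X = y , z , cross y∈S z∉S , inj₂ (z∈X , y∈Y)
...     | inj₂ z∈Y = x , z , cross x∈S z∉S , inj₁ (x∈X , z∈Y)
bipartite⇒majorityConnected {n} Q S cross S-small ∁S-small X Y disj maj (x , x∈X) (y , y∈Y)
    | no x∉S | no y∉S with count-escape (X ∪ Y) (∁ S) (*-cancelˡ-< 2 _ _ (≤-<-trans ∁S-small maj))
...   | z , z∈X∪Y , z∉∁S with T-∨⁻ (X z) z∈X∪Y
...     | inj₁ z∈X = z , y , cross (T-¬not (S z) z∉∁S) y∉S , inj₁ (z∈X , y∈Y)
...     | inj₂ z∈Y = z , x , cross (T-¬not (S z) z∉∁S) x∉S , inj₂ (x∈X , z∈Y)


module _ (k : ℕ) (d : Fin (k + k)) where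

  evenQueries : List (Query (k + k))
  evenQueries = liftQueries d (cartesianProduct (upTo k) (map (k +_) (upTo k)))

  length-evenQueries : length evenQueries ≡ target (k + k)
  length-evenQueries = begin
    length evenQueries                        ≡⟨ length-map _ (cartesianProduct (upTo k) B) ⟩
    length (cartesianProduct (upTo k) B)      ≡⟨ length-cartesianProduct (upTo k) B ⟩
    length (upTo k) * length B                ≡⟨ cong₂ _*_ (length-upTo k) (trans (length-map (k +_) (upTo k)) (length-upTo k)) ⟩
    k * k                                     ≡⟨ n≡⌈n+n/2⌉ (k * k) ⟩
    ⌈ k * k + k * k /2⌉                       ≡⟨ cong ⌈_/2⌉ (sym (*-distribˡ-+ k k k)) ⟩
    ⌈ k * (k + k) /2⌉                         ≡⟨ cong (λ h → ⌈ h * (k + k) /2⌉) (n≡⌈n+n/2⌉ k) ⟩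
    target (k + k)                            ∎
    where
    open ≡-Reasoning
    B = map (k +_) (upTo k)

  evenQueries-cross : ∀ {p q} → T (below k p) → ¬ T (below k q) → (p , q) ∈ evenQueries
  evenQueries-cross {p} {q} p<k q≮k = ∈-liftQueries d (subst (λ j → (toℕ p , j) ∈ _) (m+[n∸m]≡n k≤q)
    (∈-cartesianProduct⁺ (∈-upTo⁺ (below⁻ k p<k)) (∈-map⁺ (k +_) (∈-upTo⁺ q∸k<k))))
    where
    k≤q : k ≤ toℕ q
    k≤q = ≮⇒≥ (λ q<k → q≮k (below⁺ k q<k))
    q∸k<k : toℕ q ∸ k < k
    q∸k<k = +-cancelˡ-< k _ _ (subst (_< k + k) (sym (m+[n∸m]≡n k≤q)) (toℕ<n q))

  evenQueries-connected : MajorityConnected evenQueries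
  evenQueries-connected =
    bipartite⇒majorityConnected evenQueries A evenQueries-cross (half-side count-A) (half-side count-∁A)
    where
    A : DecSet (k + k)
    A = below k
    count-A : count A ≡ k
    count-A = count-below k (m≤m+n k k)
    count-∁A : count (∁ A) ≡ k
    count-∁A = +-cancelˡ-≡ k _ _ (trans (cong (_+ count (∁ A)) (sym count-A)) (count-∁ A))
    half-side : ∀ {a} → a ≡ k → 2 * a ≤ k + k
    half-side refl = ≤-reflexive (cong (k +_) (+-identityʳ k))

-- Odd n

allBut : ℕ → ℕ → List ℕ
allBut m j = upTo j ++ map (suc j +_) (upTo (m ∸ j))

∈-allBut : ∀ {m j x} → x ≤ m → x ≢ j → x ∈ allBut m j
∈-allBut {m} {j} {x} x≤m x≢j with <-cmp x j
... | tri< x<j _ _ = ∈-++⁺ˡ (∈-upTo⁺ x<j)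
... | tri≈ _ x≡j _ = contradiction x≡j x≢j
... | tri> _ _ j<x = ∈-++⁺ʳ (upTo j) (subst (_∈ map (suc j +_) (upTo (m ∸ j))) (m+[n∸m]≡n j<x)
                       (∈-map⁺ (suc j +_) (∈-upTo⁺ (∸-monoˡ-< (s≤s x≤m) j<x))))

length-allBut : ∀ {m j} → j ≤ m → length (allBut m j) ≡ m
length-allBut {m} {j} j≤m = trans (length-++ (upTo j))
  (trans (cong₂ _+_ (length-upTo j) (trans (length-map (suc j +_) (upTo (m ∸ j))) (length-upTo (m ∸ j)))) (m+[n∸m]≡n j≤m))

coverPairs : ℕ → List (ℕ × ℕ)
coverPairs zero          = []
coverPairs (suc zero)    = (1 , 0) ∷ []
coverPairs (suc (suc m)) = (suc m , suc (suc m)) ∷ coverPairs m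

length-coverPairs : ∀ m → 2 * length (coverPairs m) ≤ suc m
length-coverPairs zero          = z≤n
length-coverPairs (suc zero)    = ≤-refl
length-coverPairs (suc (suc m)) =
  subst (_≤ suc (suc (suc m))) (sym (*-suc 2 (length (coverPairs m)))) (s≤s (s≤s (length-coverPairs m)))

coverPairs-partner : ∀ m {i} → 1 ≤ i → i ≤ m → ∃ λ j → j ≢ i × j ≤ m × ((i , j) ∈ coverPairs m ⊎ (j , i) ∈ coverPairs m)
coverPairs-partner (suc zero) {suc zero} _ _ = 0 , (λ ()) , z≤n , inj₁ (here refl)
coverPairs-partner (suc zero) {suc (suc _)} _ (s≤s ())
coverPairs-partner (suc (suc m)) {i} 1≤i i≤m+2 with i ℕ.≟ suc (suc m) | i ℕ.≟ suc m
... | yes refl | _ = suc m , 1+n≢n ∘ sym , n≤1+n (suc m) , inj₂ (here refl)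
... | no _ | yes refl = suc (suc m) , 1+n≢n , ≤-refl , inj₁ (here refl)
... | no i≢m+2 | no i≢m+1 with coverPairs-partner m 1≤i (s≤s⁻¹ (≤∧≢⇒< (s≤s⁻¹ (≤∧≢⇒< i≤m+2 i≢m+2)) i≢m+1))
...   | j , j≢i , j≤m , ij∈ = j , j≢i , m≤n⇒m≤1+n (m≤n⇒m≤1+n j≤m) , Data.Sum.map there there ij∈

T-boundary : (φ : ℕ → Bool) (a e : ℕ) → T (φ a) → ¬ T (φ (e + a)) → ∃ λ i → i < e + a × T (φ i) × ¬ T (φ (suc i))
T-boundary φ a zero    φa ¬φa = contradiction φa ¬φa
T-boundary φ a (suc e) φa ¬φe+a+1 with T? (φ (e + a))
... | yes φe+a = e + a , n<1+n (e + a) , φe+a , ¬φe+a+1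
... | no ¬φe+a with T-boundary φ a e φa ¬φe+a
...   | i , i<e+a , φi , ¬φi+1 = i , m<n⇒m<1+n i<e+a , φi , ¬φi+1

consecutive : ∀ {i j} → 1 ≤ i → 1 ≤ j → i < 3 → j < 3 → i ≢ j → j ≡ suc i ⊎ i ≡ suc j
consecutive {1} {1} _ _ _ _ i≢j = contradiction refl i≢j
consecutive {1} {2} _ _ _ _ _   = inj₁ refl
consecutive {2} {1} _ _ _ _ _   = inj₂ refl
consecutive {2} {2} _ _ _ _ i≢j = contradiction refl i≢j
consecutive {suc (suc (suc _))} _ _ (s≤s (s≤s (s≤s ()))) _ _
consecutive {_} {suc (suc (suc _))} _ _ _ (s≤s (s≤s (s≤s ()))) _

module Odd (k′ : ℕ) where

  k 2k+1 : ℕ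
  k = suc k′
  2k+1 = suc (k + k)

  A B : DecSet 2k+1
  A = below (suc k)
  B = ∁ A

  Matched : Fin 2k+1 → Fin 2k+1 → Set
  Matched p q = 1 ≤ toℕ p × toℕ q ≡ suc k + toℕ p

  matched? : ∀ p q → Dec (Matched p q)
  matched? p q = 1 ≤? toℕ p ×-dec toℕ q ℕ.≟ suc k + toℕ p

  matched-injˡ : ∀ {p p′ q} → Matched p q → Matched p′ q → p ≡ p′
  matched-injˡ (_ , q≡p) (_ , q≡p′) = toℕ-injective (+-cancelˡ-≡ (suc k) _ _ (trans (sym q≡p) q≡p′))

  matched-injʳ : ∀ {p q q′} → Matched p q → Matched p q′ → q ≡ q′
  matched-injʳ (_ , q≡p) (_ , q′≡p) = toℕ-injective (trans q≡p (sym q′≡p))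

  matched-index< : ∀ {p q} → Matched p q → toℕ p < k
  matched-index< {p} {q} (_ , q≡p) = +-cancelˡ-< (suc k) (toℕ p) k (subst (_< 2k+1) q≡p (toℕ<n q))

  count-A : count A ≡ suc k
  count-A = count-below (suc k) (s≤s (m≤m+n k k))

  count-B : count B ≡ k
  count-B = +-cancelˡ-≡ (suc k) _ _ (trans (cong (_+ count B) (sym count-A)) (count-∁ A))

  at : ℕ → Fin 2k+1
  at = toFin zero

  module Criterion (Q : List (Query 2k+1))
    (cross : ∀ {p q} → T (A p) → T (B q) → ¬ Matched p q → (p , q) ∈ Q)
    (path : ∀ {p q} → toℕ p < k → toℕ q ≡ suc (toℕ p) → (p , q) ∈ Q)
    (cover : ∀ {p q} → Matched p q → ∃ λ r → r ≢ q × T (B r) × ((q , r) ∈ Q ⊎ (r , q) ∈ Q)) where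

    module Cut (M X Y : DecSet 2k+1) (disj : Disjoint X Y) (M⊆X∪Y : M ⊆ (X ∪ Y)) (large : suc k ≤ count M) where

      too-few : count (M ∩ A) + count (M ∖ A) ≤ k → ⊥
      too-few small = 1+n≰n (≤-trans large (≤-trans (≤-reflexive (count-split M A)) small))

      count-M∩ : ∀ S → count (M ∩ S) ≤ count (X ∩ S) + count (Y ∩ S)
      count-M∩ S = ≤-trans (count-mono split) (count-∪ (X ∩ S) (Y ∩ S))
        where
        split : (M ∩ S) ⊆ ((X ∩ S) ∪ (Y ∩ S))
        split z z∈M∩S with T-∧⁻ (M z) z∈M∩S
        ... | z∈M , z∈S with T-∨⁻ (X z) (M⊆X∪Y z z∈M)
        ...   | inj₁ z∈X = T-∨⁺ˡ _ (T-∧⁺ z∈X z∈S)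
        ...   | inj₂ z∈Y = T-∨⁺ʳ (X z ∧ S z) (T-∧⁺ z∈Y z∈S)

      in-Y : ∀ {z} → T (M z) → ¬ T (X z) → T (Y z)
      in-Y {z} z∈M z∉X with T-∨⁻ (X z) (M⊆X∪Y z z∈M)
      ... | inj₁ z∈X = contradiction z∈X z∉X
      ... | inj₂ z∈Y = z∈Y

      in-X : ∀ {z} → T (M z) → ¬ T (Y z) → T (X z)
      in-X {z} z∈M z∉Y with T-∨⁻ (X z) (M⊆X∪Y z z∈M)
      ... | inj₁ z∈X = z∈X
      ... | inj₂ z∈Y = contradiction z∈Y z∉Y

      across : ∀ {p q} → (p , q) ∈ Q → T (X p) → T (Y q) → CrossingQuery Q X Y
      across pq∈Q p∈X q∈Y = _ , _ , pq∈Q , inj₁ (p∈X , q∈Y)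

      across′ : ∀ {p q} → (p , q) ∈ Q → T (Y p) → T (X q) → CrossingQuery Q X Y
      across′ pq∈Q p∈Y q∈X = _ , _ , pq∈Q , inj₂ (q∈X , p∈Y)

      module MatchedPair {t u : Fin 2k+1} (t∈X : T (X t)) (u∈Y : T (Y u)) (t-u : Matched t u)
                         (only-t : ∀ z → T ((X ∩ A) z) → z ≡ t) (only-u : ∀ z → T ((Y ∩ B) z) → z ≡ u) where

        t<k : toℕ t < k
        t<k = matched-index< t-u

        in-A : ∀ {z} → toℕ z ≤ k → T (A z)
        in-A z≤k = below⁺ (suc k) (s≤s z≤k)

        count-X∩A : count (X ∩ A) ≤ 1
        count-X∩A = count-≤1 (X ∩ A) t only-t

        count-Y∩B : count (Y ∩ B) ≤ 1
        count-Y∩B = count-≤1 (Y ∩ B) u only-u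

        prev next : Fin 2k+1
        prev = at (toℕ t ∸ 1)
        next = at (suc (toℕ t))

        toℕ-prev : toℕ prev ≡ toℕ t ∸ 1
        toℕ-prev = toℕ-toFin zero (≤-<-trans (m∸n≤m (toℕ t) 1) (toℕ<n t))

        toℕ-next : toℕ next ≡ suc (toℕ t)
        toℕ-next = toℕ-toFin zero (s≤s (≤-trans t<k (m≤m+n k k)))

        prev<k : toℕ prev < k
        prev<k = subst (_< k) (sym toℕ-prev) (≤-<-trans (m∸n≤m (toℕ t) 1) t<k)

        t-after-prev : toℕ t ≡ suc (toℕ prev)
        t-after-prev = trans (sym (m+[n∸m]≡n (proj₁ t-u))) (cong suc (sym toℕ-prev))

        prev∈A : T (A prev)
        prev∈A = in-A (<⇒≤ prev<k)

        next∈A : T (A next)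
        next∈A = in-A (subst (_≤ k) (sym toℕ-next) t<k)

        prev≢t : prev ≢ t
        prev≢t prev≡t = 1+n≢n (sym (trans t-after-prev (cong (suc ∘ toℕ) prev≡t)))

        next≢t : next ≢ t
        next≢t next≡t = 1+n≢n (trans (sym toℕ-next) (cong toℕ next≡t))

        prev≢next : prev ≢ next
        prev≢next prev≡next =
          <⇒≢ (<-trans (≤-reflexive (sym t-after-prev)) (≤-reflexive (sym toℕ-next))) (cong toℕ prev≡next)

        -- Here X = {t}.  If M contained neither path neighbour of t, it would miss two balls of A and
        -- contain at most u from B, so it would have at most k balls.
        X-singleton : (∀ z → ¬ T ((X ∩ B) z)) → CrossingQuery Q X Y
        X-singleton X∩B=∅ with T? (M prev) | T? (M next)
        ... | yes prev∈M | _ = across′ (path prev<k t-after-prev) (in-Y prev∈M prev∉X) t∈X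
          where
          prev∉X : ¬ T (X prev)
          prev∉X prev∈X = prev≢t (only-t prev (T-∧⁺ prev∈X prev∈A))
        ... | no _ | yes next∈M = across (path t<k toℕ-next) t∈X (in-Y next∈M next∉X)
          where
          next∉X : ¬ T (X next)
          next∉X next∈X = next≢t (only-t next (T-∧⁺ next∈X next∈A))
        ... | no prev∉M | no next∉M = ⊥-elim (too-few (≤-trans (+-monoʳ-≤ (count (M ∩ A)) count-M∖A) A-part))
          where
          M∩A-misses : 2 + count (M ∩ A) ≤ suc k
          M∩A-misses = subst (2 + count (M ∩ A) ≤_) count-A (count-mono-<₂ prev next prev≢next
            (∩-⊆ʳ M A) (prev∉M ∘ ∩-⊆ˡ M A prev) (next∉M ∘ ∩-⊆ˡ M A next) prev∈A next∈A)
          A-part : count (M ∩ A) + 1 ≤ k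
          A-part = subst (_≤ k) (+-comm 1 (count (M ∩ A))) (s≤s⁻¹ M∩A-misses)
          count-M∖A : count (M ∖ A) ≤ 1
          count-M∖A = ≤-trans (count-M∩ B) (+-mono-≤ (count-none (X ∩ B) X∩B=∅) count-Y∩B)

        -- Here Y = {u}.  If M missed the cover partner r of u, it would miss a ball of B and contain at
        -- most t from A, so it would have at most k balls.
        Y-singleton : (∀ z → ¬ T ((Y ∩ A) z)) → CrossingQuery Q X Y
        Y-singleton Y∩A=∅ with cover t-u
        ... | r , r≢u , r∈B , ur∈Q with T? (M r)
        ...   | yes r∈M = via ur∈Q
          where
          r∈X : T (X r)
          r∈X = in-X r∈M λ r∈Y → r≢u (only-u r (T-∧⁺ r∈Y r∈B))
          via : (u , r) ∈ Q ⊎ (r , u) ∈ Q → CrossingQuery Q X Y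
          via (inj₁ ur∈Q) = across′ ur∈Q u∈Y r∈X
          via (inj₂ ru∈Q) = across ru∈Q r∈X u∈Y
        ...   | no r∉M = ⊥-elim (too-few (≤-trans (+-monoˡ-≤ (count (M ∖ A)) count-M∩A) B-part))
          where
          B-part : suc (count (M ∖ A)) ≤ k
          B-part = subst (suc (count (M ∖ A)) ≤_) count-B
            (count-mono-< r (∩-⊆ʳ M B) (r∉M ∘ ∩-⊆ˡ M B r) r∈B)
          count-M∩A : count (M ∩ A) ≤ 1
          count-M∩A = ≤-trans (count-M∩ A) (≤-trans (+-mono-≤ count-X∩A (count-none (Y ∩ A) Y∩A=∅)) (≤-reflexive (+-identityʳ 1)))

        four-quadrants : ∀ {a b} → T ((Y ∩ A) a) → T ((X ∩ B) b) → CrossingQuery Q X Y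
        four-quadrants {a} {b} a∈Y∩A b∈X∩B with T-∧⁻ (Y a) a∈Y∩A | T-∧⁻ (X b) b∈X∩B | matched? a b
        ... | a∈Y , a∈A | b∈X , b∈B | no a≁b = across′ (cross a∈A b∈B a≁b) a∈Y b∈X
        ... | a∈Y , a∈A | b∈X , b∈B | yes a-b with singleton-or-other (X ∩ B) b | singleton-or-other (Y ∩ A) a
        ...   | inj₂ (b′ , b′∈X∩B , b′≢b) | _ =
                let b′∈X , b′∈B = T-∧⁻ (X b′) b′∈X∩B in across′ (cross a∈A b′∈B (b′≢b ∘ sym ∘ matched-injʳ a-b)) a∈Y b′∈X
        ...   | inj₁ _ | inj₂ (a′ , a′∈Y∩A , a′≢a) =
                let a′∈Y , a′∈A = T-∧⁻ (Y a′) a′∈Y∩A in across′ (cross a′∈A b∈B (a′≢a ∘ sym ∘ matched-injˡ a-b)) a′∈Y b∈X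
        -- Each of X ∩ A, X ∩ B, Y ∩ A, Y ∩ B is now a single ball, so k ≤ 3 and the matched balls t and a
        -- of A are 1 and 2, which are joined by the path.
        ...   | inj₁ only-b | inj₁ only-a
          with consecutive (proj₁ t-u) (proj₁ a-b) (≤-trans t<k k≤3) (≤-trans (matched-index< a-b) k≤3) t≢a
          where
          t≢a : toℕ t ≢ toℕ a
          t≢a t≡a = disj t t∈X (subst (T ∘ Y) (sym (toℕ-injective t≡a)) a∈Y)
          k≤3 : k ≤ 3
          k≤3 = s≤s⁻¹ (≤-trans large (≤-trans (≤-reflexive (count-split M A)) (+-mono-≤
                  (≤-trans (count-M∩ A) (+-mono-≤ count-X∩A (count-≤1 (Y ∩ A) a only-a)))
                  (≤-trans (count-M∩ B) (+-mono-≤ (count-≤1 (X ∩ B) b only-b) count-Y∩B)))))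
        ...     | inj₁ a≡t+1 = across (path t<k a≡t+1) t∈X a∈Y
        ...     | inj₂ t≡a+1 = across′ (path (matched-index< a-b) t≡a+1) a∈Y t∈X

      cross-side : ∀ {t u} → T ((X ∩ A) t) → T ((Y ∩ B) u) → CrossingQuery Q X Y
      cross-side {t} {u} t∈X∩A u∈Y∩B with T-∧⁻ (X t) t∈X∩A | T-∧⁻ (Y u) u∈Y∩B | matched? t u
      ... | t∈X , t∈A | u∈Y , u∈B | no t≁u = across (cross t∈A u∈B t≁u) t∈X u∈Y
      ... | t∈X , t∈A | u∈Y , u∈B | yes t-u with singleton-or-other (X ∩ A) t | singleton-or-other (Y ∩ B) u
      ...   | inj₂ (t′ , t′∈X∩A , t′≢t) | _ =
              let t′∈X , t′∈A = T-∧⁻ (X t′) t′∈X∩A in across (cross t′∈A u∈B (t′≢t ∘ sym ∘ matched-injˡ t-u)) t′∈X u∈Y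
      ...   | inj₁ _ | inj₂ (u′ , u′∈Y∩B , u′≢u) =
              let u′∈Y , u′∈B = T-∧⁻ (Y u′) u′∈Y∩B in across (cross t∈A u′∈B (u′≢u ∘ sym ∘ matched-injʳ t-u)) t∈X u′∈Y
      ...   | inj₁ only-t | inj₁ only-u with empty-or-witness (X ∩ B) | empty-or-witness (Y ∩ A)
      ...     | inj₁ X∩B=∅ | _                = MatchedPair.X-singleton t∈X u∈Y t-u only-t only-u X∩B=∅
      ...     | inj₂ _ | inj₁ Y∩A=∅           = MatchedPair.Y-singleton t∈X u∈Y t-u only-t only-u Y∩A=∅
      ...     | inj₂ (b , b∈) | inj₂ (a , a∈) = MatchedPair.four-quadrants t∈X u∈Y t-u only-t only-u a∈ b∈

    path-crossing< : ∀ {X Y : DecSet 2k+1} → A ⊆ (X ∪ Y) → Disjoint X Y →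
                     ∀ {x y} → toℕ x < toℕ y → T (X x) → T (Y y) → T (A y) → CrossingQuery Q X Y
    path-crossing< {X} {Y} A⊆X∪Y disj {x} {y} x<y x∈X y∈Y y∈A
      with T-boundary (X ∘ at) (toℕ x) (toℕ y ∸ toℕ x) (subst (T ∘ X) (sym (toFin-toℕ zero x)) x∈X)
             (subst (¬_ ∘ T ∘ X) (sym (trans (cong at y∸x+x≡y) (toFin-toℕ zero y))) λ y∈X → disj y y∈X y∈Y)
      where
      y∸x+x≡y : toℕ y ∸ toℕ x + toℕ x ≡ toℕ y
      y∸x+x≡y = m∸n+n≡m (<⇒≤ x<y)
    ... | i , i<y′ , i∈X , i+1∉X = at i , at (suc i) , path i<k′ toℕ-at-suc , inj₁ (i∈X , i+1∈Y)
      where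
      i<k : i < k
      i<k = <-≤-trans (subst (i <_) (m∸n+n≡m (<⇒≤ x<y)) i<y′) (s≤s⁻¹ (below⁻ (suc k) y∈A))
      toℕ-at : toℕ (at i) ≡ i
      toℕ-at = toℕ-toFin zero (<-trans i<k (s≤s (m≤m+n k k)))
      toℕ-at-suc : toℕ (at (suc i)) ≡ suc (toℕ (at i))
      toℕ-at-suc = trans (toℕ-toFin zero (s≤s (≤-trans i<k (m≤m+n k k)))) (cong suc (sym toℕ-at))
      i<k′ : toℕ (at i) < k
      i<k′ = subst (_< k) (sym toℕ-at) i<k
      i+1∈Y : T (Y (at (suc i)))
      i+1∈Y with T-∨⁻ (X (at (suc i))) (A⊆X∪Y (at (suc i)) (below⁺ (suc k) (subst (_< suc k) (sym toℕ-at-suc) (s≤s i<k′))))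
      ... | inj₁ i+1∈X = contradiction i+1∈X i+1∉X
      ... | inj₂ i+1∈Y = i+1∈Y

    path-crossing : ∀ {X Y : DecSet 2k+1} → A ⊆ (X ∪ Y) → Disjoint X Y →
                    ∀ {x y} → T (X x) → T (A x) → T (Y y) → T (A y) → CrossingQuery Q X Y
    path-crossing {X} {Y} A⊆X∪Y disj {x} {y} x∈X x∈A y∈Y y∈A with <-cmp (toℕ x) (toℕ y)
    ... | tri< x<y _ _ = path-crossing< A⊆X∪Y disj x<y x∈X y∈Y y∈A
    ... | tri≈ _ x≡y _ = ⊥-elim (disj x x∈X (subst (T ∘ Y) (sym (toℕ-injective x≡y)) y∈Y))
    ... | tri> _ _ y<x =
          CrossingQuery-sym (path-crossing< (λ z → ∪-comm-⊆ X Y z ∘ A⊆X∪Y z) (λ z z∈Y z∈X → disj z z∈X z∈Y) y<x y∈Y x∈X x∈A)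

    module Majority (X Y : DecSet 2k+1) (disj : Disjoint X Y) (maj : 2k+1 < 2 * count (X ∪ Y)) where

      large : suc k ≤ count (X ∪ Y)
      large = *-cancelˡ-< 2 k (count (X ∪ Y))
        (subst (_< 2 * count (X ∪ Y)) (cong (k +_) (sym (+-identityʳ k))) (<-trans (n<1+n (k + k)) maj))

      module C₁ = Cut (X ∪ Y) X Y disj (λ _ z∈M → z∈M) large
      module C₂ = Cut (X ∪ Y) Y X (λ z z∈Y z∈X → disj z z∈X z∈Y) (∪-comm-⊆ X Y) large

      connect : ∃ (T ∘ X) → ∃ (T ∘ Y) → CrossingQuery Q X Y
      connect (x , x∈X) (y , y∈Y) with T? (A x) | T? (A y)
      ... | yes x∈A | no  y∉A = C₁.cross-side (T-∧⁺ x∈X x∈A) (T-∧⁺ y∈Y (T-not⁺ y∉A))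
      ... | no  x∉A | yes y∈A = CrossingQuery-sym (C₂.cross-side (T-∧⁺ y∈Y y∈A) (T-∧⁺ x∈X (T-not⁺ x∉A)))
      ... | yes x∈A | yes y∈A with empty-or-witness (Y ∩ B) | empty-or-witness (X ∩ B)
      ...   | inj₂ (u , u∈Y∩B) | _ = C₁.cross-side (T-∧⁺ x∈X x∈A) u∈Y∩B
      ...   | inj₁ _ | inj₂ (u , u∈X∩B) = CrossingQuery-sym (C₂.cross-side (T-∧⁺ y∈Y y∈A) u∈X∩B)
      ...   | inj₁ Y∩B=∅ | inj₁ X∩B=∅ = path-crossing A⊆M disj x∈X x∈A y∈Y y∈A
        where
        M⊆A : (X ∪ Y) ⊆ A
        M⊆A z z∈M with T? (A z) | T-∨⁻ (X z) z∈M
        ... | yes z∈A | _        = z∈A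
        ... | no  z∉A | inj₁ z∈X = ⊥-elim (X∩B=∅ z (T-∧⁺ z∈X (T-not⁺ z∉A)))
        ... | no  z∉A | inj₂ z∈Y = ⊥-elim (Y∩B=∅ z (T-∧⁺ z∈Y (T-not⁺ z∉A)))
        A⊆M : A ⊆ (X ∪ Y)
        A⊆M a a∈A with T? ((X ∪ Y) a)
        ... | yes a∈M = a∈M
        ... | no  a∉M = ⊥-elim (1+n≰n (≤-trans large
                          (s≤s⁻¹ (subst (suc (count (X ∪ Y)) ≤_) count-A (count-mono-< a M⊆A a∉M a∈A)))))
      connect (x , x∈X) (y , y∈Y)
        | no x∉A | no y∉A with empty-or-witness (X ∩ A) | empty-or-witness (Y ∩ A)
      ...   | inj₂ (t , t∈X∩A) | _ = C₁.cross-side t∈X∩A (T-∧⁺ y∈Y (T-not⁺ y∉A))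
      ...   | inj₁ _ | inj₂ (t , t∈Y∩A) = CrossingQuery-sym (C₂.cross-side t∈Y∩A (T-∧⁺ x∈X (T-not⁺ x∉A)))
      ...   | inj₁ X∩A=∅ | inj₁ Y∩A=∅ = ⊥-elim (1+n≰n (≤-trans large (subst (count (X ∪ Y) ≤_) count-B (count-mono M⊆B))))
        where
        M⊆B : (X ∪ Y) ⊆ B
        M⊆B z z∈M with T? (A z) | T-∨⁻ (X z) z∈M
        ... | no  z∉A | _        = T-not⁺ z∉A
        ... | yes z∈A | inj₁ z∈X = ⊥-elim (X∩A=∅ z (T-∧⁺ z∈X z∈A))
        ... | yes z∈A | inj₂ z∈Y = ⊥-elim (Y∩A=∅ z (T-∧⁺ z∈Y z∈A))

    majorityConnected : MajorityConnected Q
    majorityConnected X Y disj maj = Majority.connect X Y disj maj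

  -- All of A × B except the pairs (i, k+1+i) with 1 ≤ i ≤ k′; the degree this removes is spent on
  -- the path 0 — 1 — … — k through A and on pairs covering those B-balls.
  oddEdges : List (ℕ × ℕ)
  oddEdges = map (_, suc k) (upTo (suc k))
          ++ concatMap (λ j → map (_, suc k + suc j) (allBut k (suc j))) (upTo k′)
          ++ map (λ i → i , suc i) (upTo k)
          ++ map (λ (i , j) → suc k + i , suc k + j) (coverPairs k′)

  oddQueries : List (Query 2k+1)
  oddQueries = liftQueries zero oddEdges

  ∈-oddEdges-cross : ∀ {x} j → x ≤ k → j < k → (∀ {i} → j ≡ suc i → x ≢ suc i) → (x , suc k + j) ∈ oddEdges
  ∈-oddEdges-cross {x} zero x≤k _ _ =
    ∈-++⁺ˡ (subst (λ y → (x , y) ∈ map (_, suc k) (upTo (suc k))) (sym (+-identityʳ (suc k)))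
      (∈-map⁺ (_, suc k) (∈-upTo⁺ (s≤s x≤k))))
  ∈-oddEdges-cross {x} (suc i) x≤k i<k′ x≢ = ∈-++⁺ʳ (map (_, suc k) (upTo (suc k))) (∈-++⁺ˡ
    (∈-concatMap⁺′ (λ j → map (_, suc k + suc j) (allBut k (suc j))) (∈-upTo⁺ (s≤s⁻¹ i<k′))
      (∈-map⁺ (_, suc k + suc i) (∈-allBut x≤k (x≢ refl)))))

  oddQueries-cross : ∀ {p q} → T (A p) → T (B q) → ¬ Matched p q → (p , q) ∈ oddQueries
  oddQueries-cross {p} {q} p∈A q∈B p≁q = ∈-liftQueries zero (subst (λ y → (toℕ p , y) ∈ oddEdges) q≡k+j
    (∈-oddEdges-cross j (s≤s⁻¹ (below⁻ (suc k) p∈A)) j<k λ j≡i+1 p≡i+1 →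
      p≁q (subst (1 ≤_) (sym p≡i+1) (s≤s z≤n) , trans (sym q≡k+j) (cong (suc k +_) (trans j≡i+1 (sym p≡i+1))))))
    where
    k<q : suc k ≤ toℕ q
    k<q = ≮⇒≥ (T-not⁻ _ q∈B ∘ below⁺ (suc k))
    j : ℕ
    j = toℕ q ∸ suc k
    q≡k+j : suc k + j ≡ toℕ q
    q≡k+j = m+[n∸m]≡n k<q
    j<k : j < k
    j<k = +-cancelˡ-< (suc k) j k (subst (_< 2k+1) (sym q≡k+j) (toℕ<n q))

  oddQueries-path : ∀ {p q} → toℕ p < k → toℕ q ≡ suc (toℕ p) → (p , q) ∈ oddQueries
  oddQueries-path {p} {q} p<k q≡p+1 = ∈-liftQueries zero (subst (λ y → (toℕ p , y) ∈ oddEdges) (sym q≡p+1)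
    (∈-++⁺ʳ (map (_, suc k) (upTo (suc k))) (∈-++⁺ʳ (concatMap _ (upTo k′)) (∈-++⁺ˡ (∈-map⁺ (λ i → i , suc i) (∈-upTo⁺ p<k))))))

  oddQueries-cover : ∀ {p q} → Matched p q → ∃ λ r → r ≢ q × T (B r) × ((q , r) ∈ oddQueries ⊎ (r , q) ∈ oddQueries)
  oddQueries-cover {p} {q} (1≤p , q≡k+p) with coverPairs-partner k′ 1≤p (s≤s⁻¹ (matched-index< (1≤p , q≡k+p)))
  ... | j , j≢p , j≤k′ , pj∈ = r , r≢q , r∈B , Data.Sum.map (lift-cover q≡k+p toℕ-r) (lift-cover toℕ-r q≡k+p) pj∈
    where
    r : Fin 2k+1
    r = at (suc k + j)
    toℕ-r : toℕ r ≡ suc k + j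
    toℕ-r = toℕ-toFin zero (s≤s (+-monoʳ-< k (s≤s j≤k′)))
    r≢q : r ≢ q
    r≢q r≡q = j≢p (+-cancelˡ-≡ (suc k) j (toℕ p) (trans (sym toℕ-r) (trans (cong toℕ r≡q) q≡k+p)))
    r∈B : T (B r)
    r∈B = T-not⁺ λ r∈A → m+n≮m (suc k) j (subst (_< suc k) toℕ-r (below⁻ (suc k) r∈A))
    lift-cover : ∀ {u v a b} → toℕ u ≡ suc k + a → toℕ v ≡ suc k + b → (a , b) ∈ coverPairs k′ → (u , v) ∈ oddQueries
    lift-cover {u} {v} u≡ v≡ ab∈ = ∈-liftQueries zero (subst₂ (λ x y → (x , y) ∈ oddEdges) (sym u≡) (sym v≡)
      (∈-++⁺ʳ (map (_, suc k) (upTo (suc k))) (∈-++⁺ʳ (concatMap _ (upTo k′)) (∈-++⁺ʳ (map (λ i → i , suc i) (upTo k))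
        (∈-map⁺ (λ (i , j) → suc k + i , suc k + j) ab∈)))))

  length-oddEdges : length oddEdges ≡ suc k + (k′ * k + (k + length (coverPairs k′)))
  length-oddEdges = begin
    length oddEdges ≡⟨ length-++ (map (_, suc k) (upTo (suc k))) ⟩
    _ ≡⟨ cong₂ _+_ (trans (length-map _ (upTo (suc k))) (length-upTo (suc k))) (length-++ (concatMap _ (upTo k′))) ⟩
    _ ≡⟨ cong (suc k +_) (cong₂ _+_ rows (length-++ (map (λ i → i , suc i) (upTo k)))) ⟩
    _ ≡⟨ cong (λ x → suc k + (k′ * k + x)) (cong₂ _+_ (trans (length-map _ (upTo k)) (length-upTo k)) (length-map _ (coverPairs k′))) ⟩
    suc k + (k′ * k + (k + length (coverPairs k′))) ∎
    where
    open ≡-Reasoning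
    rows : length (concatMap (λ j → map (_, suc k + suc j) (allBut k (suc j))) (upTo k′)) ≡ k′ * k
    rows = trans
      (length-concatMap _ (upTo k′) λ {j} j∈ → trans (length-map _ (allBut k (suc j))) (length-allBut (m≤n⇒m≤1+n (∈-upTo⁻ j∈))))
                 (cong (_* k) (length-upTo k′))

  length-oddQueries : length oddQueries ≤ target 2k+1
  length-oddQueries = begin
    length oddQueries ≡⟨ trans (length-map _ oddEdges) length-oddEdges ⟩
    L                 ≤⟨ 2*m≤n⇒m≤⌊n/2⌋ L twice-L ⟩
    ⌊ suc (suc k * 2k+1) /2⌋ ≡⟨ cong (λ h → ⌈ h * 2k+1 /2⌉) (cong suc (n≡⌊n+n/2⌋ k)) ⟩
    target 2k+1          ∎
    where
    open ≤-Reasoning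
    L = suc k + (k′ * k + (k + length (coverPairs k′)))
    expand-L : ∀ k′ c → 2 * (suc (suc k′) + (k′ * suc k′ + (suc k′ + c))) ≡ 2 * c + (2 * k′ * k′ + 6 * k′ + 6)
    expand-L = solve-∀
    expand-target : ∀ k′ → suc (suc (suc k′) * suc (suc k′ + suc k′)) ≡ suc k′ + (2 * k′ * k′ + 6 * k′ + 6)
    expand-target = solve-∀
    twice-L : 2 * L ≤ suc (suc k * 2k+1)
    twice-L = begin
      2 * L ≡⟨ expand-L k′ (length (coverPairs k′)) ⟩
      2 * length (coverPairs k′) + (2 * k′ * k′ + 6 * k′ + 6) ≤⟨ +-monoˡ-≤ _ (length-coverPairs k′) ⟩
      suc k′ + (2 * k′ * k′ + 6 * k′ + 6) ≡⟨ sym (expand-target k′) ⟩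
      suc (suc k * 2k+1) ∎

  oddQueries-connected : MajorityConnected oddQueries
  oddQueries-connected = Criterion.majorityConnected oddQueries oddQueries-cross oddQueries-path oddQueries-cover

-- Lower bound: every ball takes part in at least ⌈n/2⌉ queries

indicator : Bool → ℕ
indicator b = if b then 1 else 0

sum-indicator : (X : DecSet n) → sum (indicator ∘ X) ≡ count X
sum-indicator {zero}  X = refl
sum-indicator {suc n} X with X zero
... | true  = cong suc (sum-indicator (X ∘ suc))
... | false = sum-indicator (X ∘ suc)

*≤sum : (h : ℕ) (f : Fin n → ℕ) → (∀ i → h ≤ f i) → n * h ≤ sum f
*≤sum {zero}  h f h≤f = z≤n
*≤sum {suc n} h f h≤f = +-mono-≤ (h≤f zero) (*≤sum h (f ∘ suc) (h≤f ∘ suc))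

incidence : Query n → Fin n → ℕ
incidence (a , b) v = indicator (⁅ a ⁆ v) + indicator (⁅ b ⁆ v)

degree : List (Query n) → Fin n → ℕ
degree []      v = 0
degree (q ∷ Q) v = incidence q v + degree Q v

handshake : (Q : List (Query n)) → sum (degree Q) ≡ 2 * length Q
handshake {n} [] = trans (sum-indicator (∅ {n})) (count-∅ {n})
handshake ((a , b) ∷ Q) = begin
  sum (λ v → incidence (a , b) v + degree Q v)          ≡⟨ ∑-distrib-+ (incidence (a , b)) (degree Q) ⟩
  sum (incidence (a , b)) + sum (degree Q)
    ≡⟨ cong₂ _+_ (∑-distrib-+ (indicator ∘ ⁅ a ⁆) (indicator ∘ ⁅ b ⁆)) (handshake Q) ⟩
  sum (indicator ∘ ⁅ a ⁆) + sum (indicator ∘ ⁅ b ⁆) + 2 * length Q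
    ≡⟨ cong (_+ 2 * length Q)
         (cong₂ _+_ (trans (sum-indicator ⁅ a ⁆) (count-⁅⁆ a)) (trans (sum-indicator ⁅ b ⁆) (count-⁅⁆ b))) ⟩
  2 + 2 * length Q                                       ≡⟨ sym (*-suc 2 (length Q)) ⟩
  2 * length ((a , b) ∷ Q)                               ∎
  where open ≡-Reasoning

adjacent : List (Query n) → Fin n → DecSet n
adjacent []      v u = false
adjacent (q ∷ Q) v u = joins q v u ∨ adjacent Q v u

adjacent-∈ : {Q : List (Query n)} {v u : Fin n} → (v , u) ∈ Q ⊎ (u , v) ∈ Q → T (adjacent Q v u)
adjacent-∈ {v = v} {u} (inj₁ (here refl)) = T-∨⁺ˡ _ (T-∨⁺ˡ _ (T-∧⁺ (≟⁺ v v refl) (≟⁺ u u refl)))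
adjacent-∈ {v = v} {u} (inj₂ (here refl)) = T-∨⁺ˡ _ (T-∨⁺ʳ (⁅ u ⁆ v ∧ ⁅ v ⁆ u) (T-∧⁺ (≟⁺ u u refl) (≟⁺ v v refl)))
adjacent-∈ {Q = q ∷ Q} {v} {u} (inj₁ (there vu∈Q)) = T-∨⁺ʳ (joins q v u) (adjacent-∈ (inj₁ vu∈Q))
adjacent-∈ {Q = q ∷ Q} {v} {u} (inj₂ (there uv∈Q)) = T-∨⁺ʳ (joins q v u) (adjacent-∈ (inj₂ uv∈Q))

count-guarded⁅⁆ : (g : Bool) (w : Fin n) → count (λ u → g ∧ ⁅ w ⁆ u) ≡ indicator g
count-guarded⁅⁆     true  w = count-⁅⁆ w
count-guarded⁅⁆ {n} false w = count-∅ {n}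

count-joins : (q : Query n) (v : Fin n) → count (joins q v) ≤ incidence q v
count-joins (a , b) v = ≤-trans (count-∪ (λ u → ⁅ a ⁆ v ∧ ⁅ b ⁆ u) (λ u → ⁅ a ⁆ u ∧ ⁅ b ⁆ v)) (≤-reflexive (cong₂ _+_
  (count-guarded⁅⁆ (⁅ a ⁆ v) b)
  (trans (count-cong (λ u → ∧-comm (⁅ a ⁆ u) (⁅ b ⁆ v))) (count-guarded⁅⁆ (⁅ b ⁆ v) a))))

count-adjacent : (Q : List (Query n)) (v : Fin n) → count (adjacent Q v) ≤ degree Q v
count-adjacent {n} []      v = ≤-reflexive (count-∅ {n})
count-adjacent     (q ∷ Q) v = ≤-trans (count-∪ (joins q v) (adjacent Q v)) (+-mono-≤ (count-joins q v) (count-adjacent Q v))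

count-shrink : (X : DecSet n) (k : ℕ) → k ≤ count X → Σ[ R ∈ DecSet n ] (R ⊆ X × count R ≡ k)
count-shrink {zero}  X zero z≤n = ∅ , (λ _ ()) , refl
count-shrink {suc n} X k k≤X with X zero in X₀
count-shrink {suc n} X zero    k≤X | _ = ∅ , (λ _ ()) , count-∅ {suc n}
count-shrink {suc n} X (suc k) k≤X | true with count-shrink (X ∘ suc) k (≤-pred k≤X)
... | R , R⊆X , count-R = (true ∷ᶠ R) , R∷⊆X , cong suc count-R
  where
  R∷⊆X : (true ∷ᶠ R) ⊆ X
  R∷⊆X zero    _ = subst T (sym X₀) _
  R∷⊆X (suc i) i∈R = R⊆X i i∈R
count-shrink {suc n} X k       k≤X | false with count-shrink (X ∘ suc) k k≤X
... | R , R⊆X , count-R = (false ∷ᶠ R) , R∷⊆X , count-R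
  where
  R∷⊆X : (false ∷ᶠ R) ⊆ X
  R∷⊆X (suc i) i∈R = R⊆X i i∈R

indistinguishable⇒¬solves : ∀ {c} (Q : List (Query n)) (χ₁ χ₂ : Coloring n c) → answers χ₁ Q ≡ answers χ₂ Q →
  ∃ (IsMajorityBall χ₁) → (∀ b → ¬ IsMajorityBall χ₂ b) → ¬ Solves n c Q
indistinguishable⇒¬solves Q χ₁ χ₂ same maj₁ ∄maj₂ (out , correct) =
  contradicts (out (answers χ₁ Q)) (correct χ₁) (subst (CorrectOutput χ₂ ∘ out) (sym same) (correct χ₂))
  where
  contradicts : (o : Maybe _) → CorrectOutput χ₁ o → CorrectOutput χ₂ o → ⊥
  contradicts nothing  ok₁ _   = ok₁ maj₁
  contradicts (just b) _   ok₂ = ∄maj₂ b ok₂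

module Fooling {c′ : ℕ} (2≤n : 2 ≤ n) (Q : List (Query n)) (v : Fin n) (R : DecSet n)
               (v∉R : ¬ T (R v)) (R-far : ∀ u → T (R u) → ¬ T (adjacent Q v u))
               (count-R : count R ≡ ⌊ n /2⌋) where

  red blue green : Fin (3 + c′)
  red   = zero
  blue  = suc zero
  green = suc (suc zero)

  -- Only v changes colour, and every ball queried against v is blue in both colourings.
  paint : Fin (3 + c′) → Coloring n (3 + c′)
  paint c u = if ⁅ v ⁆ u then c else if R u then red else blue

  same-answer : ∀ {i j} → (i , j) ∈ Q → answer (paint red) (i , j) ≡ answer (paint green) (i , j)
  same-answer {i} {j} ij∈Q with i ≟ v | j ≟ v
  ... | yes _ | yes _ = refl
  ... | no  _ | no  _ = refl
  ... | yes refl | no _ with R j in Rj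
  ...   | false = refl
  ...   | true  = ⊥-elim (R-far j (subst T (sym Rj) _) (adjacent-∈ (inj₁ ij∈Q)))
  same-answer {i} {j} ij∈Q | no _ | yes refl with R i in Ri
  ...   | false = refl
  ...   | true  = ⊥-elim (R-far i (subst T (sym Ri) _) (adjacent-∈ (inj₂ ij∈Q)))

  same-answers : answers (paint red) Q ≡ answers (paint green) Q
  same-answers = map-cong-local (All.tabulate same-answer)

  V : DecSet n
  V = ⁅ v ⁆ ∪ R

  count-R<count-V : count R < count V
  count-R<count-V = count-mono-< v (λ u → T-∨⁺ʳ (⁅ v ⁆ u)) v∉R (T-∨⁺ˡ _ (≟⁺ v v refl))

  red-on-V : ∀ u → T (V u) → paint red u ≡ red
  red-on-V u u∈V with ⁅ v ⁆ u | R u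
  ... | true  | _    = refl
  ... | false | true = refl

  V⊆red-class : V ⊆ colourClass (paint red) v
  V⊆red-class u u∈V = ≟⁺ _ _ (trans (red-on-V u u∈V) (sym (red-on-V v (T-∨⁺ˡ _ (≟⁺ v v refl)))))

  paint-green : ∀ u → paint green u ≡ green × T (⁅ v ⁆ u) ⊎ paint green u ≡ red × T (R u) ⊎ paint green u ≡ blue × T (∁ V u)
  paint-green u with ⁅ v ⁆ u | R u
  ... | true  | _     = inj₁ (refl , _)
  ... | false | true  = inj₂ (inj₁ (refl , _))
  ... | false | false = inj₂ (inj₂ (refl , _))

  green-class : ∀ b → paint green b ≡ green → colourClass (paint green) b ⊆ ⁅ v ⁆
  green-class b pb u u∈C with paint-green u | trans (≟⁻ _ _ u∈C) pb
  ... | inj₁ (_ , u∈)          | _  = u∈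
  ... | inj₂ (inj₁ (pu , _)) | pu′ = contradiction (trans (sym pu) pu′) λ ()
  ... | inj₂ (inj₂ (pu , _)) | pu′ = contradiction (trans (sym pu) pu′) λ ()

  red-class : ∀ b → paint green b ≡ red → colourClass (paint green) b ⊆ R
  red-class b pb u u∈C with paint-green u | trans (≟⁻ _ _ u∈C) pb
  ... | inj₂ (inj₁ (_ , u∈)) | _   = u∈
  ... | inj₁ (pu , _)        | pu′ = contradiction (trans (sym pu) pu′) λ ()
  ... | inj₂ (inj₂ (pu , _)) | pu′ = contradiction (trans (sym pu) pu′) λ ()

  blue-class : ∀ b → paint green b ≡ blue → colourClass (paint green) b ⊆ ∁ V
  blue-class b pb u u∈C with paint-green u | trans (≟⁻ _ _ u∈C) pb
  ... | inj₂ (inj₂ (_ , u∈)) | _   = u∈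
  ... | inj₁ (pu , _)        | pu′ = contradiction (trans (sym pu) pu′) λ ()
  ... | inj₂ (inj₁ (pu , _)) | pu′ = contradiction (trans (sym pu) pu′) λ ()

  ⌊n/2⌋<count-V : ⌊ n /2⌋ < count V
  ⌊n/2⌋<count-V = subst (_< count V) count-R count-R<count-V

  red-majority : IsMajorityBall (paint red) v
  red-majority = count⇒majority (paint red) v
    (<-≤-trans (n<2*[1+⌊n/2⌋] n) (*-monoʳ-≤ 2 (≤-trans ⌊n/2⌋<count-V (count-mono V⊆red-class))))

  green-classes-small : ∀ b → count (colourClass (paint green) b) ≤ ⌊ n /2⌋
  green-classes-small b with paint-green b
  ... | inj₁ (pb , _) =
        ≤-trans (count-mono (green-class b pb)) (≤-trans (≤-reflexive (count-⁅⁆ v)) (⌊n/2⌋-mono 2≤n))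
  ... | inj₂ (inj₁ (pb , _)) = ≤-trans (count-mono (red-class b pb)) (≤-reflexive count-R)
  ... | inj₂ (inj₂ (pb , _)) = ≤-trans (count-mono (blue-class b pb)) (small-complement ⌊n/2⌋<count-V (count-∁ V))

  green-no-majority : ∀ b → ¬ IsMajorityBall (paint green) b
  green-no-majority b maj = <⇒≱ (majority⇒count (paint green) b maj)
    (≤-trans (*-monoʳ-≤ 2 (green-classes-small b)) (2*⌊n/2⌋≤n n))

  fooled : ¬ Solves n (3 + c′) Q
  fooled = indistinguishable⇒¬solves Q (paint red) (paint green) same-answers (v , red-majority) green-no-majority

lower-bound : ∀ {c′} → 2 ≤ n → (Q : List (Query n)) → Solves n (3 + c′) Q → target n ≤ length Q
lower-bound {n} 2≤n Q solves = m≤2*n⇒⌈m/2⌉≤n (length Q) (begin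
  ⌈ n /2⌉ * n       ≡⟨ *-comm ⌈ n /2⌉ n ⟩
  n * ⌈ n /2⌉       ≤⟨ *≤sum ⌈ n /2⌉ (degree Q) high-degree ⟩
  sum (degree Q)    ≡⟨ handshake Q ⟩
  2 * length Q      ∎)
  where
  open ≤-Reasoning
  high-degree : ∀ v → ⌈ n /2⌉ ≤ degree Q v
  high-degree v with ⌈ n /2⌉ ≤? degree Q v
  ... | yes h≤d = h≤d
  ... | no  h≰d
    with count-shrink U ⌊ n /2⌋ (large-complement closed-small (trans (+-comm (count U) (count closed)) (count-∁ closed)))
    where
    closed U : DecSet n
    closed = ⁅ v ⁆ ∪ adjacent Q v
    U = ∁ closed
    closed-small : count closed ≤ ⌈ n /2⌉
    closed-small = ≤-trans (count-∪ ⁅ v ⁆ (adjacent Q v))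
      (≤-trans (+-mono-≤ (≤-reflexive (count-⁅⁆ v)) (count-adjacent Q v)) (≰⇒> h≰d))
  ... | R , R⊆U , count-R = ⊥-elim (Fooling.fooled 2≤n Q v R v∉R R-far count-R solves)
    where
    v∉R : ¬ T (R v)
    v∉R v∈R = T-not⁻ _ (R⊆U v v∈R) (T-∨⁺ˡ _ (≟⁺ v v refl))
    R-far : ∀ u → T (R u) → ¬ T (adjacent Q v u)
    R-far u u∈R u~v = T-not⁻ _ (R⊆U u u∈R) (T-∨⁺ʳ (⁅ v ⁆ u) u~v)

data Parity : ℕ → Set where
  even : ∀ k → Parity (k + k)
  odd  : ∀ k → Parity (suc (k + k))

parity : ∀ n → Parity n
parity zero          = even zero
parity (suc zero)    = odd zero
parity (suc (suc n)) with parity n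
... | even k = subst Parity (cong suc (+-suc k k)) (even (suc k))
... | odd  k = subst Parity (cong (2 +_) (+-suc k k)) (odd (suc k))

connected-queries : ∀ n → 3 ≤ n → Σ[ Q ∈ List (Query n) ] (length Q ≡ target n × MajorityConnected Q)
connected-queries n 3≤n with parity n
connected-queries .(zero + zero)         () | even zero
connected-queries .(suc k + suc k)       _  | even (suc k) =
  evenQueries (suc k) zero , length-evenQueries (suc k) zero , evenQueries-connected (suc k) zero
connected-queries .(suc (zero + zero))   (s≤s ()) | odd zero
connected-queries .(suc (suc k′ + suc k′)) _ | odd (suc k′) =
  padTo zero (target (suc (suc k′ + suc k′))) (Odd.oddQueries k′) (Odd.length-oddQueries k′)
    (Odd.oddQueries-connected k′)

theorem1 : (n c : ℕ) → 2 < c → c ≤ n → MinQueries c n (target n)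
theorem1 n (suc (suc (suc c′))) (s≤s (s≤s (s≤s _))) c≤n with connected-queries n (≤-trans (s≤s (s≤s (s≤s z≤n))) c≤n)
... | Q , length-Q , connected =
  (Q , length-Q , majorityConnected⇒solves Q connected) , lower-bound (≤-trans (s≤s (s≤s z≤n)) c≤n)
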